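{- Let $G=(V,E)$ be a DAG with topological order $v_1,\ldots,v_{|V|}$, and for $i\in\{0,\ldots,|V|\}$ let $G_i=G[\{v_1,\ldots,v_i\}]$ (with $G_0$ the empty graph). For every $i\in\{1,\ldots,|V|\}$, if $A$ is a $G_i$-frontier antichain with $v_i\notin A$, then $A$ is a $G_{i-1}$-frontier antichain.
   Context: A topological order is an ordering of the vertices such that every edge goes from an earlier to a later vertex. In a directed graph $H$, $u$ reaches $v$ if there is a path (sequence of distinct vertices, consecutive ones joined by edges of $H$, at least one vertex) from $u$ to $v$ in $H$. An antichain of $H$ is a set of vertices no one of which reaches a different one in $H$. A set $A$ reaches $v$ if some $u\in A$ reaches $v$. For antichains $A,B$ of $H$ of the same size, $B$ dominates $A$ (in $H$) if for every $b\in B$, $A$ reaches $b$ in $H$; antichains of different sizes are not related. An antichain of $H$ is an $H$-frontier antichain if it is not dominated in $H$ by any other antichain of $H$. -}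

module Defs where

open import Data.Nat using (ℕ; _<_)
open import Data.Fin using (Fin; toℕ)
open import Data.Fin.Subset using (Subset; _∈_; _∉_; _⊆_; ∣_∣)
open import Data.Fin.Permutation using (Permutation; _⟨$⟩ˡ_; _⟨$⟩ʳ_)
open import Data.Product using (Σ; ∃; _×_; _,_)
open import Relation.Binary.PropositionalEquality using (_≡_; _≢_)
open import Relation.Nullary using (¬_)
open import Level using (0ℓ; suc)

Graph : ℕ → Set₁
Graph n = Fin n → Fin n → Set

-- A topological order v₁,…,v_n of G, encoded as a permutation π with
-- v_(k+1) = π ⟨$⟩ʳ k (0-based index k); every edge goes from an earlier
-- to a later vertex.  (Existence of such an order makes G a DAG.)
IsTopOrder : ∀ {n} → Graph n → Permutation n n → Set
IsTopOrder {n} E π = ∀ u v → E u v → toℕ (π ⟨$⟩ˡ u) < toℕ (π ⟨$⟩ˡ v)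

-- Vertex set of G_i = G[{v₁,…,v_i}] : vertices of position < i.
Prefix : ∀ {n} → Permutation n n → ℕ → Fin n → Set
Prefix π i v = toℕ (π ⟨$⟩ˡ v) < i

data Reaches {n} (E : Graph n) (S : Fin n → Set) : Fin n → Fin n → Set where
  here : ∀ {u} → S u → Reaches E S u u
  step : ∀ {u w v} → S u → E u w → Reaches E S w v → Reaches E S u v

IsAntichain : ∀ {n} → Graph n → (Fin n → Set) → Subset n → Set
IsAntichain E S A =
  (∀ v → v ∈ A → S v) ×
  (∀ u v → u ∈ A → v ∈ A → u ≢ v → ¬ Reaches E S u v)

Dominates : ∀ {n} → Graph n → (Fin n → Set) → Subset n → Subset n → Set
Dominates E S B A =
  (∣ A ∣ ≡ ∣ B ∣) × (∀ b → b ∈ B → ∃ λ a → a ∈ A × Reaches E S a b)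

IsFrontier : ∀ {n} → Graph n → (Fin n → Set) → Subset n → Set
IsFrontier E S A =
  IsAntichain E S A ×
  (∀ B → IsAntichain E S B → B ≢ A → ¬ Dominates E S B A)

module Submission where

open import Defs
open import Data.Nat using (suc; _≤_)
open import Data.Nat.Properties using (<-trans; <-≤-trans; n≤1+n; m<1+n⇒m<n∨m≡n)
open import Data.Fin using (Fin; toℕ)
open import Data.Fin.Properties using (toℕ-injective)
open import Data.Fin.Subset using (Subset; _∈_; _∉_)
open import Data.Fin.Permutation using (Permutation; _⟨$⟩ʳ_; inverseʳ)
open import Data.Product using (_,_; proj₁)
open import Data.Sum using (_⊎_; inj₁; inj₂)
open import Relation.Nullary using (contradiction)
open import Relation.Binary.PropositionalEquality using (_≡_; sym; trans; cong; subst)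

-- Prefixes of a topological order are closed under predecessors, so a
-- G_j-frontier antichain lying in G_i (i ≤ j) is compared in G_i with exactly
-- the same antichains and reachabilities that matter in G_j: reachability
-- towards a vertex of G_i never leaves G_i, and enlarging the graph only adds
-- paths.

module _ {n} {E : Graph n} where

  Reaches-source : ∀ {S u w} → Reaches E S u w → S u
  Reaches-source (here s)     = s
  Reaches-source (step s _ _) = s

  Reaches-mono : ∀ {S T : Fin n → Set} → (∀ {v} → S v → T v) →
                 ∀ {u w} → Reaches E S u w → Reaches E T u w
  Reaches-mono S⊆T (here s)     = here (S⊆T s)
  Reaches-mono S⊆T (step s e r) = step (S⊆T s) e (Reaches-mono S⊆T r)

  Dominates-mono : ∀ {S T : Fin n → Set} → (∀ {v} → S v → T v) →
                   ∀ {A B} → Dominates E S B A → Dominates E T B A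
  Dominates-mono S⊆T (sameSize , reachedFromA) =
    sameSize , λ b b∈B → let a , a∈A , r = reachedFromA b b∈B
                         in a , a∈A , Reaches-mono S⊆T r

  IsAntichain-restrict : ∀ {S T : Fin n → Set} → (∀ {v} → S v → T v) →
                         ∀ {A} → (∀ v → v ∈ A → S v) →
                         IsAntichain E T A → IsAntichain E S A
  IsAntichain-restrict S⊆T A⊆S (_ , indep) =
    A⊆S , λ u v u∈A v∈A u≢v r → indep u v u∈A v∈A u≢v (Reaches-mono S⊆T r)

module _ {n} (π : Permutation n n) where

  Prefix-mono : ∀ {i j} → i ≤ j → ∀ {v} → Prefix π i v → Prefix π j v
  Prefix-mono i≤j v<i = <-≤-trans v<i i≤j

  Prefix-suc⁻ : ∀ i {v} → Prefix π (suc (toℕ i)) v →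
                Prefix π (toℕ i) v ⊎ v ≡ π ⟨$⟩ʳ i
  Prefix-suc⁻ i v<1+i with m<1+n⇒m<n∨m≡n v<1+i
  ... | inj₁ v<i = inj₁ v<i
  ... | inj₂ v≡i = inj₂ (trans (sym (inverseʳ π)) (cong (π ⟨$⟩ʳ_) (toℕ-injective v≡i)))

module _ {n} {E : Graph n} (π : Permutation n n) (top : IsTopOrder E π) where

  -- Positions strictly increase along a path, so every vertex on it precedes
  -- the target.
  Reaches-restrictToPrefix : ∀ {S i u w} → Reaches E S u w → Prefix π i w →
                             Reaches E (Prefix π i) u w
  Reaches-restrictToPrefix (here _)     w<i = here w<i
  Reaches-restrictToPrefix (step _ e r) w<i =
    step (<-trans (top _ _ e) (Reaches-source r′)) e r′
    where r′ = Reaches-restrictToPrefix r w<i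

  IsAntichain-extendPrefix : ∀ {i j} → i ≤ j → ∀ {B} →
                             IsAntichain E (Prefix π i) B →
                             IsAntichain E (Prefix π j) B
  IsAntichain-extendPrefix i≤j (B⊆Gᵢ , indep) =
    (λ v v∈B → Prefix-mono π i≤j (B⊆Gᵢ v v∈B)) ,
    λ u v u∈B v∈B u≢v r →
      indep u v u∈B v∈B u≢v (Reaches-restrictToPrefix r (B⊆Gᵢ v v∈B))

  IsFrontier-restrictPrefix : ∀ {i j} → i ≤ j → ∀ {A} →
                              (∀ v → v ∈ A → Prefix π i v) →
                              IsFrontier E (Prefix π j) A →
                              IsFrontier E (Prefix π i) A
  IsFrontier-restrictPrefix i≤j A⊆Gᵢ (antichain , undominated) =
    IsAntichain-restrict (Prefix-mono π i≤j) A⊆Gᵢ antichain ,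
    λ B B-antichain B≢A B-dominates →
      undominated B (IsAntichain-extendPrefix i≤j B-antichain) B≢A
                  (Dominates-mono (Prefix-mono π i≤j) B-dominates)

lemma5 : ∀ {n} (E : Graph n) (π : Permutation n n) → IsTopOrder E π →
    (i : Fin n) (A : Subset n) →
    IsFrontier E (Prefix π (suc (toℕ i))) A →
    (π ⟨$⟩ʳ i) ∉ A →
    IsFrontier E (Prefix π (toℕ i)) A
lemma5 E π top i A frontier vᵢ∉A =
  IsFrontier-restrictPrefix π top (n≤1+n _) A⊆Gᵢ₋₁ frontier
  where
  A⊆Gᵢ₋₁ : ∀ v → v ∈ A → Prefix π (toℕ i) v
  A⊆Gᵢ₋₁ v v∈A with Prefix-suc⁻ π i (proj₁ (proj₁ frontier) v v∈A)
  ... | inj₁ v<i  = v<i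
  ... | inj₂ v≡vᵢ = contradiction (subst (_∈ A) v≡vᵢ v∈A) vᵢ∉A
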